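{- Let $n,x\in\mathbb{N}$. There is a bound $B=B(n,x)$, primitive recursive in $(n,x)$, such that for every finite tree $(T,\preceq)$ isomorphic to $(B^{\le 2n-1},\preceq)$ and every coloring $f:[\mathrm{Leaves}(T)]^2\to 2$, there is a subset $S\subseteq T$ such that $(S,\preceq)\cong(x^{\le n},\preceq)$, $\mathrm{Leaves}(S)\subseteq\mathrm{Leaves}(T)$ and $f$ is constant on $[\mathrm{Leaves}(S)]^2$.
   Context: For $B,d\in\mathbb{N}$, $B^{\le d}$ denotes the set of finite sequences of length at most $d$ over $\{0,\dots,B-1\}$, and $\preceq$ the prefix order. A tree here is a set $T$ of finite sequences with the restriction of the prefix order (not required to be prefix-closed); when $(T,\preceq)\cong(B^{\le d},\preceq)$, $\mathrm{Leaves}(T)$ denotes the set of elements corresponding to sequences of length exactly $d$ (the maximal elements). Similarly for $S$. -}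

module Defs where

open import Data.Nat using (ℕ; zero; suc; _≤_; _*_; _∸_)
open import Data.Fin using (Fin)
open import Data.Vec using (Vec; []; _∷_; lookup; map)
open import Data.List using (List; length; _++_)
open import Data.Product using (Σ; ∃; _×_; _,_; proj₁)
open import Relation.Binary.PropositionalEquality using (_≡_)
open import Function.Bundles using (_⇔_)

data PR : ℕ → Set where
  zeroF : ∀ {k} → PR k
  succF : PR 1
  projF : ∀ {k} → Fin k → PR k
  compF : ∀ {k m} → PR m → Vec (PR k) m → PR k
  recF  : ∀ {k} → PR k → PR (suc (suc k)) → PR (suc k)

mutual
  eval : ∀ {k} → PR k → Vec ℕ k → ℕ
  eval zeroF xs = 0
  eval succF (x ∷ []) = suc x
  eval (projF i) xs = lookup xs i
  eval (compF f gs) xs = eval f (evalAll gs xs)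
  eval (recF g h) (zero ∷ xs) = eval g xs
  eval (recF g h) (suc y ∷ xs) = eval h (y ∷ eval (recF g h) (y ∷ xs) ∷ xs)

  evalAll : ∀ {k m} → Vec (PR k) m → Vec ℕ k → Vec ℕ m
  evalAll [] xs = []
  evalAll (g ∷ gs) xs = eval g xs ∷ evalAll gs xs

PrimRec₂ : (ℕ → ℕ → ℕ) → Set
PrimRec₂ F = Σ (PR 2) λ p → ∀ n x → eval p (n ∷ x ∷ []) ≡ F n x

_⪯_ : ∀ {A : Set} → List A → List A → Set
σ ⪯ τ = ∃ λ ρ → σ ++ ρ ≡ τ

Seq≤ : ℕ → ℕ → Set
Seq≤ B d = Σ (List (Fin B)) λ s → length s ≤ d

-- An order isomorphism from (B^{≤ d}, ⪯) onto its image in (List ℕ, ⪯):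
-- the tree T = image φ, with (T,⪯) ≅ (B^{≤d},⪯) via φ.
IsTreeEmbedding : ∀ {B d} → (Seq≤ B d → List ℕ) → Set
IsTreeEmbedding {B} {d} φ =
  ∀ (σ τ : Seq≤ B d) → (proj₁ σ ⪯ proj₁ τ) ⇔ (φ σ ⪯ φ τ)

InTree : ∀ {B d} → (Seq≤ B d → List ℕ) → List ℕ → Set
InTree {B} {d} φ t = ∃ λ (σ : Seq≤ B d) → φ σ ≡ t

InLeaves : ∀ {B d} → (Seq≤ B d → List ℕ) → List ℕ → Set
InLeaves {B} {d} φ t = ∃ λ (σ : Seq≤ B d) → (length (proj₁ σ) ≡ d) × (φ σ ≡ t)

-- A symmetric two-colouring of pairs of leaves is first made canonical: inside a level-preserving
-- copy of (x+1)^{≤2n-1}, the colour of two distinct leaves depends only on the level at which they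
-- split. This goes level by level: a product Ramsey theorem for tuples of level-preserving subtrees
-- (itself an iterated product pigeonhole principle) shrinks the subtrees below the first-level nodes
-- until the colour of leaves in different subtrees depends only on their first-level nodes, Ramsey's
-- theorem for pairs makes that dependence constant, and induction plus pigeonhole handles the subtrees.
-- Of the 2n-1 splitting levels, n carry the same colour c, and spreading x^{≤n} over those levels
-- (with 0 on the others) gives a subtree whose distinct leaves all split at a level of colour c.
-- All bounds are built from +, *, ^ and iteration, hence primitive recursive.

module Submission where

open import Defs

open import Data.Nat using (ℕ; zero; suc; _+_; _*_; _^_; _∸_; _≤_; _<_; z≤n; s≤s; _≤?_; _≟_)
open import Data.Nat.Properties
open import Data.Fin as Fin
  using (Fin; toℕ; inject≤; funToFin; finToFun; combine; quotient; remQuot) renaming (zero to 0F)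
open import Data.Fin.Properties
  using (finToFun-funToFin; remQuot-combine; toℕ<n; toℕ-injective; toℕ-inject≤; inject≤-injective; ¬Fin0)
  renaming (<-cmp to <-cmpF; suc-injective to Fin-suc-injective)
open import Data.List using (List; []; _∷_; length; lookup; filter; allFin; replicate; take)
open import Data.List.Properties using (length-tabulate; length-replicate; ∷-injective; length-take; take-all)
open import Data.List.Membership.Propositional.Properties using (∈-lookup)
open import Data.List.Relation.Unary.All as All using (All; []; _∷_)
open import Data.List.Relation.Unary.All.Properties using (all-filter) renaming (filter⁺ to All-filter⁺)
open import Data.List.Relation.Unary.AllPairs using (AllPairs; []; _∷_)
open import Data.List.Relation.Unary.Unique.Propositional using (Unique)
open import Data.List.Relation.Unary.Unique.Propositional.Properties using (allFin⁺)
open import Data.List.Relation.Binary.Sublist.Propositional using (_⊆_; []; _∷_; _∷ʳ_; ⊆-trans)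
open import Data.List.Relation.Binary.Sublist.Propositional.Properties using (All-resp-⊆; filter-⊆; []⊆-universal)
open import Data.Vec as Vec using (Vec; []; _∷_)
open import Data.Vec.Properties using (tabulate∘lookup; tabulate-cong)
open import Data.Vec.Functional using (Vector; head; tail; map; zipWith; _⊛_; updateAt) renaming (_∷_ to _◂_)
open import Data.Vec.Functional.Properties using (updateAt-updates; updateAt-minimal)
open import Data.Product using (Σ; ∃; ∃₂; _×_; _,_; proj₁; proj₂)
open import Data.Sum using (_⊎_; inj₁; inj₂)
open import Data.Unit using (⊤; tt)
open import Data.Empty using (⊥-elim)
open import Function.Base using (_∘_; const)
open import Function.Bundles using (_↣_; mk↣; Injection; _⇔_; mk⇔)
open import Function.Construct.Composition using (_⇔-∘_)
open import Function.Properties.Injection using (↣-trans)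
open import Relation.Nullary using (Dec; yes; no; ¬_)
open import Relation.Nullary.Decidable using (T?)
open import Data.Bool using (Bool; true; false)
open import Relation.Unary using (Decidable)
open import Relation.Unary.Properties using (∁?)
open import Relation.Binary.PropositionalEquality
open import Relation.Binary.Core using (_Preserves_⟶_)
open import Relation.Binary.Definitions using (tri<; tri≈; tri>)

open Injection using (to)

pattern 1F = Fin.suc 0F

-- Pigeonhole principle and Ramsey's theorem for pairs

module _ {A : Set} where

  Monochromatic : (A → A → Fin 2) → Fin 2 → List A → Set
  Monochromatic col c = AllPairs (λ u w → col u w ≡ c)

  AllPairs-resp-⊆ : {R : A → A → Set} {S L : List A} → S ⊆ L → AllPairs R L → AllPairs R S
  AllPairs-resp-⊆ [] [] = []
  AllPairs-resp-⊆ (_ ∷ʳ S⊆L) (_ ∷ rs) = AllPairs-resp-⊆ S⊆L rs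
  AllPairs-resp-⊆ (refl ∷ S⊆L) (r ∷ rs) = All-resp-⊆ S⊆L r ∷ AllPairs-resp-⊆ S⊆L rs

  length-filter-∁ : {P : A → Set} (P? : Decidable P) (xs : List A) →
    length (filter P? xs) + length (filter (∁? P?) xs) ≡ length xs
  length-filter-∁ P? [] = refl
  length-filter-∁ P? (x ∷ xs) with P? x
  ... | yes _ = cong suc (length-filter-∁ P? xs)
  ... | no _ = trans (+-suc _ _) (cong suc (length-filter-∁ P? xs))

  pigeonhole : ∀ r y (g : A → ℕ) {L : List A} → All (λ a → g a < r) L → y * r < length L →
    ∃₂ λ c S → S ⊆ L × All (λ a → g a ≡ c) S × y ≤ length S
  pigeonhole zero y g {a ∷ L} (() ∷ _) _
  pigeonhole (suc r) y g {L} g<r long = split (y ≤? length (filter top? L))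
    where
    top? = λ a → g a ≟ r
    below : All (λ a → g a < r) (filter (∁? top?) L)
    below = All.zipWith (λ (lt , ne) → ≤∧≢⇒< (≤-pred lt) ne)
              (All-filter⁺ (∁? top?) g<r , all-filter (∁? top?) L)
    y*r<rest : length (filter top? L) < y → y * r < length (filter (∁? top?) L)
    y*r<rest few = +-cancelˡ-≤ y _ _ (begin
      y + suc (y * r)                         ≡⟨ +-suc y (y * r) ⟩
      suc (y + y * r)                         ≡⟨ cong suc (*-suc y r) ⟨
      suc (y * suc r)                         ≤⟨ long ⟩
      length L                                ≡⟨ length-filter-∁ top? L ⟨
      length (filter top? L) + length (filter (∁? top?) L) ≤⟨ +-monoˡ-≤ _ (<⇒≤ few) ⟩
      y + length (filter (∁? top?) L)         ∎)
      where open ≤-Reasoning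
    split : Dec (y ≤ length (filter top? L)) → ∃₂ λ c S → S ⊆ L × All (λ a → g a ≡ c) S × y ≤ length S
    split (yes enough) = r , filter top? L , filter-⊆ top? L , all-filter top? L , enough
    split (no few) =
      let c , S , S⊆ , mono , enough = pigeonhole r y g below (y*r<rest (≰⇒> few))
      in c , S , ⊆-trans S⊆ (filter-⊆ (∁? top?) L) , mono , enough

  HomogeneousSublist : (A → A → Fin 2) → ℕ → ℕ → List A → Set
  HomogeneousSublist col a b L = ∃ λ S → S ⊆ L ×
    (Monochromatic col 0F S × a ≤ length S ⊎ Monochromatic col 1F S × b ≤ length S)

  ramsey : (col : A → A → Fin 2) (a b : ℕ) (L : List A) → 2 ^ (a + b) ≤ length L →
    HomogeneousSublist col a b L
  ramsey col zero b L _ = [] , []⊆-universal L , inj₁ ([] , z≤n)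
  ramsey col (suc a) zero L _ = [] , []⊆-universal L , inj₂ ([] , z≤n)
  ramsey col (suc a) (suc b) [] big = ⊥-elim (<⇒≱ (m^n>0 2 (suc a + suc b)) big)
  ramsey col (suc a) (suc b) (v ∷ L) big = split (2 ^ (a + suc b) ≤? length (filter red? L))
    where
    red? = λ w → col v w Fin.≟ 0F
    X = 2 ^ (a + suc b)

    extend₀ : HomogeneousSublist col a (suc b) (filter red? L) →
      HomogeneousSublist col (suc a) (suc b) (v ∷ L)
    extend₀ (S , S⊆ , inj₁ (mono , long)) =
      v ∷ S , refl ∷ ⊆-trans S⊆ (filter-⊆ red? L) ,
      inj₁ (All-resp-⊆ S⊆ (all-filter red? L) ∷ mono , s≤s long)
    extend₀ (S , S⊆ , inj₂ homog) = S , v ∷ʳ ⊆-trans S⊆ (filter-⊆ red? L) , inj₂ homog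

    extend₁ : HomogeneousSublist col (suc a) b (filter (∁? red?) L) →
      HomogeneousSublist col (suc a) (suc b) (v ∷ L)
    extend₁ (S , S⊆ , inj₂ (mono , long)) =
      v ∷ S , refl ∷ ⊆-trans S⊆ (filter-⊆ (∁? red?) L) ,
      inj₂ (All.map ≢0F⇒≡1F (All-resp-⊆ S⊆ (all-filter (∁? red?) L)) ∷ mono , s≤s long)
      where
      ≢0F⇒≡1F : ∀ {c : Fin 2} → c ≢ 0F → c ≡ 1F
      ≢0F⇒≡1F {0F} c≢0 = ⊥-elim (c≢0 refl)
      ≢0F⇒≡1F {1F} _ = refl
    extend₁ (S , S⊆ , inj₁ homog) = S , v ∷ʳ ⊆-trans S⊆ (filter-⊆ (∁? red?) L) , inj₁ homog

    enough₁ : length (filter red? L) < X → 2 ^ (suc a + b) ≤ length (filter (∁? red?) L)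
    enough₁ few = subst (λ e → 2 ^ e ≤ length (filter (∁? red?) L)) (+-suc a b) (+-cancelˡ-≤ X X _ (begin
      X + X                                          ≡⟨ cong (X +_) (+-identityʳ X) ⟨
      X + (X + 0)                                    ≤⟨ big ⟩
      suc (length L)                                 ≡⟨ cong suc (length-filter-∁ red? L) ⟨
      suc (length (filter red? L) + length (filter (∁? red?) L)) ≤⟨ +-monoˡ-≤ _ few ⟩
      X + length (filter (∁? red?) L)                ∎))
      where open ≤-Reasoning

    split : Dec (X ≤ length (filter red? L)) → HomogeneousSublist col (suc a) (suc b) (v ∷ L)
    split (yes enough) = extend₀ (ramsey col a (suc b) (filter red? L) enough)
    split (no few) = extend₁ (ramsey col (suc a) b (filter (∁? red?) L) (enough₁ (≰⇒> few)))

  ramsey-diagonal : (col : A → A → Fin 2) (y : ℕ) (L : List A) → 2 ^ (y + y) ≤ length L →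
    ∃₂ λ c S → S ⊆ L × Monochromatic col c S × y ≤ length S
  ramsey-diagonal col y L big with ramsey col y y L big
  ... | S , S⊆ , inj₁ (mono , long) = 0F , S , S⊆ , mono , long
  ... | S , S⊆ , inj₂ (mono , long) = 1F , S , S⊆ , mono , long

  lookup-AllPairs : {R : A → A → Set} {S : List A} → AllPairs R S →
    ∀ {i j : Fin (length S)} → i Fin.< j → R (lookup S i) (lookup S j)
  lookup-AllPairs (r ∷ _) {0F} {Fin.suc j} _ = All.lookup r (∈-lookup j)
  lookup-AllPairs (_ ∷ rs) {Fin.suc i} {Fin.suc j} (s≤s i<j) = lookup-AllPairs rs i<j

  lookup-injective : {S : List A} → Unique S → ∀ {i j} → lookup S i ≡ lookup S j → i ≡ j
  lookup-injective (_ ∷ _) {0F} {0F} _ = refl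
  lookup-injective (x∉ ∷ _) {0F} {Fin.suc j} eq = ⊥-elim (All.lookup x∉ (∈-lookup j) eq)
  lookup-injective (x∉ ∷ _) {Fin.suc i} {0F} eq = ⊥-elim (All.lookup x∉ (∈-lookup i) (sym eq))
  lookup-injective (_ ∷ u) {Fin.suc i} {Fin.suc j} eq = cong Fin.suc (lookup-injective u eq)

module Pick {N y : ℕ} {S : List (Fin N)} (S⊆ : S ⊆ allFin N) (long : y ≤ length S) where

  pick : Fin y ↣ Fin N
  pick = mk↣ λ eq → inject≤-injective long long _ _
    (lookup-injective (AllPairs-resp-⊆ S⊆ (allFin⁺ N)) eq)

  pick-All : {P : Fin N → Set} → All P S → ∀ i → P (to pick i)
  pick-All ps i = All.lookup ps (∈-lookup (inject≤ i long))

  pick-ordered : {R : Fin N → Fin N → Set} → AllPairs R S → ∀ {i j} → i Fin.< j → R (to pick i) (to pick j)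
  pick-ordered rs {i} {j} i<j =
    lookup-AllPairs rs (subst₂ _<_ (sym (toℕ-inject≤ i long)) (sym (toℕ-inject≤ j long)) i<j)

  pick-symmetric : {R : Fin N → Fin N → Set} → (∀ {a b} → R a b → R b a) → AllPairs R S →
    ∀ {i j} → i ≢ j → R (to pick i) (to pick j)
  pick-symmetric R-sym rs {i} {j} i≢j with <-cmpF i j
  ... | tri< i<j _ _ = pick-ordered rs i<j
  ... | tri≈ _ i≡j _ = ⊥-elim (i≢j i≡j)
  ... | tri> _ _ j<i = R-sym (pick-ordered rs j<i)

length-allFin : ∀ N → length (allFin N) ≡ N
length-allFin N = length-tabulate (λ i → i)

pigeonholeFin : ∀ {r y N} → y * r < N → (g : Fin N → Fin r) →
  ∃ λ (h : Fin y ↣ Fin N) → ∀ i j → g (to h i) ≡ g (to h j)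
pigeonholeFin {r} {y} {N} y*r<N g
  with c , S , S⊆ , mono , long ← pigeonhole r y (toℕ ∘ g) (All.tabulate λ {a} _ → toℕ<n (g a))
                                    (subst (y * r <_) (sym (length-allFin N)) y*r<N)
  = pick , λ i j → toℕ-injective (trans (pick-All mono i) (sym (pick-All mono j)))
  where open Pick S⊆ long

ramseyFin : ∀ {y N} → 2 ^ (y + y) ≤ N → (col : Fin N → Fin N → Fin 2) → (∀ a b → col a b ≡ col b a) →
  ∃₂ λ (h : Fin y ↣ Fin N) c → ∀ {i j} → i ≢ j → col (to h i) (to h j) ≡ c
ramseyFin {y} {N} big col col-sym
  with c , S , S⊆ , mono , long ← ramsey-diagonal col y (allFin N)
                                    (subst (2 ^ (y + y) ≤_) (sym (length-allFin N)) big)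
  = pick , c , pick-symmetric (λ {a} {b} e → trans (col-sym b a) e) mono
  where open Pick S⊆ long

-- Product Ramsey theorems

inject≤↣ : ∀ {m n} → m ≤ n → Fin m ↣ Fin n
inject≤↣ m≤n = mk↣ (inject≤-injective m≤n m≤n _ _)

funToFin-cong : ∀ {m n} {f g : Fin m → Fin n} → f ≗ g → funToFin f ≡ funToFin g
funToFin-cong {zero} _ = refl
funToFin-cong {suc m} f≗g = cong₂ combine (f≗g 0F) (funToFin-cong (f≗g ∘ Fin.suc))

iterate : (ℕ → ℕ) → ℕ → ℕ → ℕ
iterate f zero a = a
iterate f (suc k) a = f (iterate f k a)

module _ {f : ℕ → ℕ} where

  iterate-suc : ∀ k a → iterate f k (f a) ≡ iterate f (suc k) a
  iterate-suc zero a = refl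
  iterate-suc (suc k) a = cong f (iterate-suc k a)

  module _ (f-inflationary : ∀ a → a ≤ f a) where

    iterate-inflationary : ∀ k a → a ≤ iterate f k a
    iterate-inflationary zero a = ≤-refl
    iterate-inflationary (suc k) a = ≤-trans (iterate-inflationary k a) (f-inflationary _)

    iterate-monoˡ-≤ : ∀ {k l} → k ≤ l → ∀ a → iterate f k a ≤ iterate f l a
    iterate-monoˡ-≤ {zero} {l} z≤n a = iterate-inflationary l a
    iterate-monoˡ-≤ {suc k} {suc l} (s≤s k≤l) a =
      subst₂ _≤_ (iterate-suc k a) (iterate-suc l a) (iterate-monoˡ-≤ k≤l (f a))

ProductRamsey : ℕ → ℕ → ℕ → Set
ProductRamsey k s B = ∀ {r y} → r ≤ s → y ≤ s → (c : Vector (Fin B) k → Fin r) → c Preserves _≗_ ⟶ _≡_ →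
  ∃ λ (hs : Vector (Fin y ↣ Fin B) k) → ∀ u v → c (map to hs ⊛ u) ≡ c (map to hs ⊛ v)

gridStep : ℕ → ℕ
gridStep s = suc (s * s) + (suc s ^ suc (s * s) + s)

gridStep-inflationary : ∀ s → s ≤ gridStep s
gridStep-inflationary s = ≤-trans (m≤n+m s _) (m≤n+m _ (suc (s * s)))

productRamsey : ∀ k s B → iterate gridStep k s ≤ B → ProductRamsey k s B
productRamsey k s B big {y = zero} r≤s y≤s c c-cong =
  const (inject≤↣ z≤n) , λ u v → c-cong λ i → ⊥-elim (¬Fin0 (u i))
productRamsey zero s B big {y = suc _} r≤s y≤s c c-cong = (λ ()) , λ u v → c-cong λ ()
productRamsey (suc k) s B big {r} {y@(suc _)} r≤s y≤s c c-cong = hs , homogeneous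
  where
  Y₀ = suc (y * r)
  Y₀≤ : Y₀ ≤ gridStep s
  Y₀≤ = ≤-trans (s≤s (*-mono-≤ y≤s r≤s)) (m≤m+n (suc (s * s)) _)
  big′ : iterate gridStep k (gridStep s) ≤ B
  big′ = ≤-trans (≤-reflexive (iterate-suc k s)) big
  ι : Fin Y₀ ↣ Fin B
  ι = inject≤↣ (≤-trans Y₀≤ (≤-trans (iterate-inflationary gridStep-inflationary k _) big′))
  -- the colour of a point w of the remaining k coordinates records the colours of all points (a , w)
  c′ : Vector (Fin B) k → Fin (r ^ Y₀)
  c′ w = funToFin λ a → c (to ι a ◂ w)
  r^Y₀≤ : r ^ Y₀ ≤ gridStep s
  r^Y₀≤ = ≤-trans (^-monoˡ-≤ Y₀ (≤-trans r≤s (n≤1+n s)))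
            (≤-trans (^-monoʳ-≤ (suc s) (s≤s (*-mono-≤ y≤s r≤s)))
              (≤-trans (m≤m+n _ s) (m≤n+m (suc s ^ suc (s * s) + s) (suc (s * s)))))
  tailGrid = productRamsey k (gridStep s) B big′ r^Y₀≤ (≤-trans y≤s (gridStep-inflationary s)) c′
           λ {w} {w′} w≗w′ → funToFin-cong λ a →
             c-cong {to ι a ◂ w} {to ι a ◂ w′} λ { 0F → refl ; (Fin.suc i) → w≗w′ i }
  hs′ = proj₁ tailGrid
  g : Fin Y₀ → Fin r
  g = finToFun (c′ (map to hs′ ⊛ const 0F))
  headClass = pigeonholeFin {r} {y} ≤-refl g
  hs : Vector (Fin y ↣ Fin B) (suc k)
  hs = ↣-trans (proj₁ headClass) ι ◂ hs′
  reduce : ∀ u → c (map to hs ⊛ u) ≡ g (to (proj₁ headClass) (head u))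
  reduce u = begin
    c (map to hs ⊛ u)                          ≡⟨ c-cong (λ { 0F → refl ; (Fin.suc i) → refl }) ⟩
    c (to ι a ◂ (map to hs′ ⊛ tail u))         ≡⟨ finToFun-funToFin (λ b → c (to ι b ◂ (map to hs′ ⊛ tail u))) a ⟨
    finToFun (c′ (map to hs′ ⊛ tail u)) a      ≡⟨ cong (λ z → finToFun z a) (proj₂ tailGrid (tail u) (const 0F)) ⟩
    g a                                        ∎
    where
    open ≡-Reasoning
    a = to (proj₁ headClass) (head u)
  homogeneous : ∀ u v → c (map to hs ⊛ u) ≡ c (map to hs ⊛ v)
  homogeneous u v = trans (reduce u) (trans (proj₂ headClass _ _) (sym (reduce v)))

-- Level-preserving subtrees

[]⪯ : ∀ {A : Set} (τ : List A) → [] ⪯ τ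
[]⪯ τ = τ , refl

∷-⪯ : ∀ {A : Set} (a : A) {σ τ : List A} → σ ⪯ τ → (a ∷ σ) ⪯ (a ∷ τ)
∷-⪯ a (ρ , eq) = ρ , cong (a ∷_) eq

∷-⪯⁻ : ∀ {A : Set} {a b : A} {σ τ : List A} → (a ∷ σ) ⪯ (b ∷ τ) → a ≡ b × σ ⪯ τ
∷-⪯⁻ (ρ , eq) = proj₁ (∷-injective eq) , ρ , proj₂ (∷-injective eq)

∷⋠[] : ∀ {A : Set} {a : A} {σ : List A} → ¬ (a ∷ σ) ⪯ []
∷⋠[] (_ , ())

length≤0 : ∀ {A : Set} (σ : List A) → length σ ≤ 0 → σ ≡ []
length≤0 [] _ = refl

-- A level-preserving copy of y^{≤m} in B^{≤m}: at each node the children are placed by an injection.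
data LevelEmb (y B : ℕ) : ℕ → Set where
  leaf : LevelEmb y B zero
  node : ∀ {m} → Fin y ↣ Fin B → (Fin y → LevelEmb y B m) → LevelEmb y B (suc m)

module _ {y B : ℕ} where

  embed : ∀ {m} → LevelEmb y B m → List (Fin y) → List (Fin B)
  embed leaf _ = []
  embed (node h Es) [] = []
  embed (node h Es) (a ∷ σ) = to h a ∷ embed (Es a) σ

  embed-length : ∀ {m} (E : LevelEmb y B m) {σ} → length σ ≡ m → length (embed E σ) ≡ m
  embed-length leaf _ = refl
  embed-length (node h Es) {a ∷ σ} eq = cong suc (embed-length (Es a) (suc-injective eq))

  embed-length-≤ : ∀ {m} (E : LevelEmb y B m) σ → length (embed E σ) ≤ m
  embed-length-≤ leaf _ = z≤n
  embed-length-≤ (node h Es) [] = z≤n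
  embed-length-≤ (node h Es) (a ∷ σ) = s≤s (embed-length-≤ (Es a) σ)

  embed-mono : ∀ {m} (E : LevelEmb y B m) {σ τ} → σ ⪯ τ → embed E σ ⪯ embed E τ
  embed-mono leaf _ = [] , refl
  embed-mono (node h Es) {[]} _ = []⪯ _
  embed-mono (node h Es) {a ∷ σ} {[]} σ⪯τ = ⊥-elim (∷⋠[] σ⪯τ)
  embed-mono (node h Es) {a ∷ σ} {b ∷ τ} σ⪯τ with ∷-⪯⁻ σ⪯τ
  ... | refl , σ⪯τ′ = ∷-⪯ (to h a) (embed-mono (Es a) σ⪯τ′)

  embed-reflects : ∀ {m} (E : LevelEmb y B m) σ τ → length σ ≤ m → length τ ≤ m →
    embed E σ ⪯ embed E τ → σ ⪯ τ
  embed-reflects leaf σ τ σ≤0 τ≤0 _ rewrite length≤0 σ σ≤0 | length≤0 τ τ≤0 = [] , refl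
  embed-reflects (node h Es) [] τ _ _ _ = []⪯ τ
  embed-reflects (node h Es) (a ∷ σ) [] _ _ σ⪯τ = ⊥-elim (∷⋠[] σ⪯τ)
  embed-reflects (node h Es) (a ∷ σ) (b ∷ τ) (s≤s σ≤m) (s≤s τ≤m) σ⪯τ
    with ∷-⪯⁻ σ⪯τ
  ... | ha≡hb , σ⪯τ′ with Injection.injective h ha≡hb
  ... | refl = ∷-⪯ a (embed-reflects (Es a) σ τ σ≤m τ≤m σ⪯τ′)

_⊙_ : ∀ {y Z B m} → LevelEmb Z B m → LevelEmb y Z m → LevelEmb y B m
leaf ⊙ leaf = leaf
node g Fs ⊙ node h Es = node (↣-trans h g) λ a → Fs (to h a) ⊙ Es a

embed-⊙ : ∀ {y Z B m} (F : LevelEmb Z B m) (E : LevelEmb y Z m) σ → embed (F ⊙ E) σ ≡ embed F (embed E σ)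
embed-⊙ leaf leaf σ = refl
embed-⊙ (node g Fs) (node h Es) [] = refl
embed-⊙ (node g Fs) (node h Es) (a ∷ σ) = cong (to g (to h a) ∷_) (embed-⊙ (Fs (to h a)) (Es a) σ)

unconsLeaf : ∀ {A : Set} {m} (σ : List A) → length σ ≡ suc m →
  Σ (A × List A) λ (a , ρ) → length ρ ≡ m × σ ≡ a ∷ ρ
unconsLeaf (a ∷ ρ) eq = (a , ρ) , suc-injective eq , refl

ProductTreeRamsey : ℕ → ℕ → ℕ → Set
ProductTreeRamsey m s B = ∀ {k r y} → k ≤ s → r ≤ s → y ≤ s →
  (χ : Vector (List (Fin B)) k → Fin r) → χ Preserves _≗_ ⟶ _≡_ →
  ∃ λ (Es : Vector (LevelEmb y B m) k) → ∀ σs τs → (∀ i → length (σs i) ≡ m) → (∀ i → length (τs i) ≡ m) →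
    χ (zipWith embed Es σs) ≡ χ (zipWith embed Es τs)

gridBound : ℕ → ℕ
gridBound s = iterate gridStep s s

treeStep : ℕ → ℕ
treeStep s = s * gridBound s + (suc s ^ (suc (gridBound s) ^ s) + (s + gridBound s))

treeStep-inflationary : ∀ s → s ≤ treeStep s
treeStep-inflationary s =
  ≤-trans (m≤m+n s _) (≤-trans (m≤n+m _ (suc s ^ (suc (gridBound s) ^ s))) (m≤n+m _ (s * gridBound s)))

productTreeRamsey : ∀ m s B → iterate treeStep m s ≤ B → ProductTreeRamsey m s B
productTreeRamsey zero s B _ _ _ _ χ χ-cong = const leaf , λ _ _ _ _ → χ-cong λ _ → refl
productTreeRamsey (suc m) s B _ {y = zero} _ _ _ χ χ-cong =
  const (node (inject≤↣ z≤n) λ ()) ,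
  λ σs τs σs-leaves _ → χ-cong λ i → ⊥-elim (noLeaf (σs i) (σs-leaves i))
  where
  noLeaf : (σ : List (Fin 0)) → ¬ length σ ≡ suc m
  noLeaf (a ∷ _) _ = ¬Fin0 a
productTreeRamsey (suc m) s B big {k} {r} {y@(suc _)} k≤s r≤s y≤s χ χ-cong = Es , homogeneous
  where
  Y = gridBound s
  big′ : iterate treeStep m (treeStep s) ≤ B
  big′ = ≤-trans (≤-reflexive (iterate-suc m s)) big
  ι : Fin Y ↣ Fin B
  ι = inject≤↣ (≤-trans (≤-trans (m≤n+m Y s) (≤-trans (m≤n+m _ (suc s ^ (suc Y ^ s))) (m≤n+m _ (s * Y))))
                 (≤-trans (iterate-inflationary treeStep-inflationary m _) big′))
  -- the subtree below child b of the root of tree i gets index combine i b; the colour of a tuple w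
  -- of such subtrees records the colours of all ways of extending w by one child per tree
  χ′ : Vector (List (Fin B)) (k * Y) → Fin (r ^ (Y ^ k))
  χ′ w = funToFin λ t → χ λ i → to ι (finToFun t i) ∷ w (combine i (finToFun t i))
  subtrees = productTreeRamsey m (treeStep s) B big′
    (≤-trans (*-monoˡ-≤ Y k≤s) (m≤m+n _ _))
    (≤-trans (^-monoˡ-≤ (Y ^ k) (≤-trans r≤s (n≤1+n s)))
      (≤-trans (^-monoʳ-≤ (suc s) (≤-trans (^-monoˡ-≤ k (n≤1+n Y)) (^-monoʳ-≤ (suc Y) k≤s)))
        (≤-trans (m≤m+n _ _) (m≤n+m _ (s * Y)))))
    (≤-trans y≤s (treeStep-inflationary s))
    χ′ λ {w} {w′} w≗w′ → funToFin-cong λ t → χ-cong λ i →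
      cong (to ι (finToFun t i) ∷_) (w≗w′ (combine i (finToFun t i)))
  Es′ = proj₁ subtrees
  Gc : Vector (Fin Y) k → Fin r
  Gc t = finToFun (χ′ (zipWith embed Es′ (const (replicate m 0F)))) (funToFin t)
  firstLevel = productRamsey k s Y (iterate-monoˡ-≤ gridStep-inflationary k≤s s) r≤s y≤s Gc
           λ t≗t′ → cong (finToFun _) (funToFin-cong t≗t′)
  hs = proj₁ firstLevel
  Es : Vector (LevelEmb y B (suc m)) k
  Es i = node (↣-trans (hs i) ι) λ a → Es′ (combine i (to (hs i) a))
  reduce : ∀ (as : Vector (Fin y) k) (ρs : Vector (List (Fin y)) k) → (∀ i → length (ρs i) ≡ m) →
    χ (λ i → embed (Es i) (as i ∷ ρs i)) ≡ Gc (map to hs ⊛ as)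
  reduce as ρs ρs-leaves = begin
    χ (λ i → to ι (t i) ∷ embed (Es′ (combine i (t i))) (ρs i))
      ≡⟨ χ-cong (λ i → cong (λ j → to ι (t i) ∷ embed (Es′ (combine i (t i))) (ρs j)) (quotient-combine i)) ⟨
    χ (λ i → to ι (t i) ∷ w (combine i (t i)))
      ≡⟨ χ-cong (λ i → cong (λ b → to ι b ∷ w (combine i b)) (finToFun-funToFin t i)) ⟨
    F (funToFin t)
      ≡⟨ finToFun-funToFin F (funToFin t) ⟨
    finToFun (χ′ w) (funToFin t)
      ≡⟨ cong (λ z → finToFun z (funToFin t))
           (proj₂ subtrees w₀ _ (ρs-leaves ∘ quotient Y) λ _ → length-replicate m) ⟩
    Gc t
      ∎
    where
    open ≡-Reasoning
    t = map to hs ⊛ as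
    w₀ : Vector (List (Fin y)) (k * Y)
    w₀ j = ρs (quotient Y j)
    w : Vector (List (Fin B)) (k * Y)
    w j = embed (Es′ j) (w₀ j)
    F : Fin (Y ^ k) → Fin r
    F u = χ λ i → to ι (finToFun u i) ∷ w (combine i (finToFun u i))
    quotient-combine : ∀ i {b} → quotient {k} Y (combine i b) ≡ i
    quotient-combine i {b} = cong proj₁ (remQuot-combine i b)
  leafColour : ∀ σs (leaves : ∀ i → length (σs i) ≡ suc m) →
    χ (zipWith embed Es σs) ≡ Gc (map to hs ⊛ λ i → proj₁ (proj₁ (unconsLeaf (σs i) (leaves i))))
  leafColour σs leaves =
    trans (χ-cong λ i → cong (embed (Es i)) (proj₂ (proj₂ (parts i))))
          (reduce (λ i → proj₁ (proj₁ (parts i))) (λ i → proj₂ (proj₁ (parts i))) (λ i → proj₁ (proj₂ (parts i))))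
    where
    parts = λ i → unconsLeaf (σs i) (leaves i)
  homogeneous : ∀ σs τs → (∀ i → length (σs i) ≡ suc m) → (∀ i → length (τs i) ≡ suc m) →
    χ (zipWith embed Es σs) ≡ χ (zipWith embed Es τs)
  homogeneous σs τs σs-leaves τs-leaves =
    trans (leafColour σs σs-leaves) (trans (proj₂ firstLevel _ _) (sym (leafColour τs τs-leaves)))

-- Canonical colourings of pairs of leaves

encode : ∀ {r m} → Vec (Fin r) m → Fin (r ^ m)
encode cs = funToFin (Vec.lookup cs)

encode-injective : ∀ {r m} {cs cs′ : Vec (Fin r) m} → encode cs ≡ encode cs′ → cs ≡ cs′
encode-injective {cs = cs} {cs′} eq = begin
  cs                                      ≡⟨ tabulate∘lookup cs ⟨
  Vec.tabulate (Vec.lookup cs)            ≡⟨ tabulate-cong (λ i → trans (sym (finToFun-funToFin (Vec.lookup cs) i))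
                                               (trans (cong (λ z → finToFun z i) eq) (finToFun-funToFin (Vec.lookup cs′) i))) ⟩
  Vec.tabulate (Vec.lookup cs′)           ≡⟨ tabulate∘lookup cs′ ⟩
  cs′                                     ∎
  where open ≡-Reasoning

SymmetricOn : ∀ {B} → ℕ → (List (Fin B) → List (Fin B) → Fin 2) → Set
SymmetricOn m χ = ∀ σ τ → length σ ≡ m → length τ ≡ m → χ σ τ ≡ χ τ σ

-- Two distinct leaves of y^{≤m} that first differ at level l get colour (lookup cs l).
Canonical : ∀ {y m} → Vec (Fin 2) m → (List (Fin y) → List (Fin y) → Fin 2) → Set
Canonical [] χ = ⊤
Canonical {y} {suc m} (c ∷ cs) χ =
  (∀ {i j} → i ≢ j → ∀ σ τ → length σ ≡ m → length τ ≡ m → χ (i ∷ σ) (j ∷ τ) ≡ c) ×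
  (∀ i → Canonical cs λ σ τ → χ (i ∷ σ) (i ∷ τ))

Canonical-cong : ∀ {y m} (cs : Vec (Fin 2) m) {χ χ′ : List (Fin y) → List (Fin y) → Fin 2} →
  (∀ σ τ → χ σ τ ≡ χ′ σ τ) → Canonical cs χ → Canonical cs χ′
Canonical-cong [] _ _ = tt
Canonical-cong (c ∷ cs) χ≡χ′ (split , below) =
  (λ i≢j σ τ |σ| |τ| → trans (sym (χ≡χ′ _ _)) (split i≢j σ τ |σ| |τ|)) ,
  (λ i → Canonical-cong cs (λ σ τ → χ≡χ′ _ _) (below i))

-- Enough first-level nodes for Ramsey's theorem to leave y · 2^m + 1 of them, which the pigeonhole
-- principle over the 2^m possible level colourings of their branches cuts down to y.
ramseyBound : ℕ → ℕ → ℕ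
ramseyBound m y = 2 ^ (suc (y * 2 ^ m) + suc (y * 2 ^ m))

canonicalStep : ℕ → ℕ → ℕ → ℕ
canonicalStep m y Z = R + iterate treeStep m (R + (2 ^ (R * R) + Z))
  where R = ramseyBound m y

canonicalBound : ℕ → ℕ → ℕ
canonicalBound zero y = 1
canonicalBound (suc m) y = canonicalStep m y (canonicalBound m y)

canonicalBound-positive : ∀ m y → 0 < canonicalBound m y
canonicalBound-positive zero y = s≤s z≤n
canonicalBound-positive (suc m) y = ≤-trans (m^n>0 2 (suc (y * 2 ^ m) + suc (y * 2 ^ m))) (m≤m+n _ _)

firstLevelColouring : ∀ {B} m R Z → iterate treeStep m (R + (2 ^ (R * R) + Z)) ≤ B → 0 < Z →
  (ι : Fin R → Fin B) (χ : List (Fin B) → List (Fin B) → Fin 2) → SymmetricOn (suc m) χ →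
  ∃₂ λ (Fs : Vector (LevelEmb Z B m) R) (col : Fin R → Fin R → Fin 2) → (∀ a b → col a b ≡ col b a) ×
    (∀ {a b} → a ≢ b → ∀ σ τ → length σ ≡ m → length τ ≡ m →
      χ (ι a ∷ embed (Fs a) σ) (ι b ∷ embed (Fs b) τ) ≡ col a b)
firstLevelColouring {B} m R Z big Z>0 ι χ χ-sym = Fs , col , col-sym , (λ {a} {b} → branchColour {a} {b})
  where
  S = R + (2 ^ (R * R) + Z)
  pairColour : Vector (List (Fin B)) R → Fin R × Fin R → Fin 2
  pairColour u (a , b) = χ (ι a ∷ u a) (ι b ∷ u b)
  pairColour-cong : ∀ {u u′} → u ≗ u′ → pairColour u ≗ pairColour u′
  pairColour-cong u≗u′ (a , b) = cong₂ χ (cong (ι a ∷_) (u≗u′ a)) (cong (ι b ∷_) (u≗u′ b))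
  ξ : Vector (List (Fin B)) R → Fin (2 ^ (R * R))
  ξ u = funToFin (pairColour u ∘ remQuot R)
  subtrees = productTreeRamsey m S B big
               (m≤m+n R _) (≤-trans (m≤m+n _ Z) (m≤n+m _ R)) (≤-trans (m≤n+m Z _) (m≤n+m _ R))
               ξ λ u≗u′ → funToFin-cong λ q → pairColour-cong u≗u′ (remQuot R q)
  Fs = proj₁ subtrees
  leaf₀ = replicate m (Fin.fromℕ< Z>0)
  leaf₀-length = length-replicate m
  col : Fin R → Fin R → Fin 2
  col a b = finToFun (ξ (zipWith embed Fs (const leaf₀))) (combine a b)
  branchColour : ∀ {a b} → a ≢ b → ∀ σ τ → length σ ≡ m → length τ ≡ m →
    χ (ι a ∷ embed (Fs a) σ) (ι b ∷ embed (Fs b) τ) ≡ col a b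
  branchColour {a} {b} a≢b σ τ |σ| |τ| = begin
    χ (ι a ∷ embed (Fs a) σ) (ι b ∷ embed (Fs b) τ)
      ≡⟨ cong₂ (λ σ′ τ′ → χ (ι a ∷ embed (Fs a) σ′) (ι b ∷ embed (Fs b) τ′))
           (updateAt-updates a (const τ)) (updateAt-minimal b a (const τ) (a≢b ∘ sym)) ⟨
    pairColour u (a , b)                         ≡⟨ cong (pairColour u) (remQuot-combine a b) ⟨
    pairColour u (remQuot R (combine a b))       ≡⟨ finToFun-funToFin (pairColour u ∘ remQuot R) (combine a b) ⟨
    finToFun (ξ u) (combine a b)                 ≡⟨ cong (λ z → finToFun z (combine a b))
                                                      (proj₂ subtrees σs (const leaf₀) σs-leaves λ _ → leaf₀-length) ⟩
    col a b                                      ∎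
    where
    open ≡-Reasoning
    σs = updateAt (const τ) a (const σ)
    u = zipWith embed Fs σs
    σs-leaves : ∀ c → length (σs c) ≡ m
    σs-leaves c with c Fin.≟ a
    ... | yes c≡a = trans (cong (length ∘ σs) c≡a) (trans (cong length (updateAt-updates a (const τ))) |σ|)
    ... | no c≢a = trans (cong length (updateAt-minimal c a (const τ) c≢a)) |τ|
  col-sym : ∀ a b → col a b ≡ col b a
  col-sym a b with a Fin.≟ b
  ... | yes refl = refl
  ... | no a≢b = begin
    col a b                                                  ≡⟨ branchColour a≢b leaf₀ leaf₀ leaf₀-length leaf₀-length ⟨
    χ (ι a ∷ embed (Fs a) leaf₀) (ι b ∷ embed (Fs b) leaf₀)   ≡⟨ χ-sym _ _ (cong suc (embed-length (Fs a) leaf₀-length))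
                                                                    (cong suc (embed-length (Fs b) leaf₀-length)) ⟩
    χ (ι b ∷ embed (Fs b) leaf₀) (ι a ∷ embed (Fs a) leaf₀)   ≡⟨ branchColour (a≢b ∘ sym) leaf₀ leaf₀ leaf₀-length leaf₀-length ⟩
    col b a                                                  ∎
    where open ≡-Reasoning

canonical : ∀ m y B → canonicalBound m y ≤ B → (χ : List (Fin B) → List (Fin B) → Fin 2) → SymmetricOn m χ →
  ∃₂ λ (E : LevelEmb y B m) (cs : Vec (Fin 2) m) → Canonical cs λ σ τ → χ (embed E σ) (embed E τ)
canonical zero y B _ χ _ = leaf , [] , tt
canonical (suc m) zero B _ χ _ =
  node (inject≤↣ z≤n) (λ ()) , Vec.replicate (suc m) 0F , (λ {i} → ⊥-elim (¬Fin0 i)) , λ i → ⊥-elim (¬Fin0 i)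
canonical (suc m) y@(suc _) B big χ χ-sym = E , c₁ ∷ levels (to p 0F) , (λ {i} {j} → split {i} {j}) , below
  where
  Z = canonicalBound m y
  Y₀ = suc (y * 2 ^ m)
  R = ramseyBound m y
  ι : Fin R ↣ Fin B
  ι = inject≤↣ (≤-trans (m≤m+n R _) big)
  firstLevel = firstLevelColouring m R Z (≤-trans (m≤n+m _ R) big) (canonicalBound-positive m y) (to ι) χ χ-sym
  Fs = proj₁ firstLevel
  col = proj₁ (proj₂ firstLevel)
  branchColour = λ {a} {b} → proj₂ (proj₂ (proj₂ firstLevel)) {a} {b}
  pairs = ramseyFin {Y₀} ≤-refl col (proj₁ (proj₂ (proj₂ firstLevel)))
  g = proj₁ pairs
  c₁ = proj₁ (proj₂ pairs)
  branch : Fin Y₀ → List (Fin Z) → List (Fin Z) → Fin 2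
  branch i σ τ = χ (to ι (to g i) ∷ embed (Fs (to g i)) σ) (to ι (to g i) ∷ embed (Fs (to g i)) τ)
  branchCanonical : ∀ i → ∃₂ λ (E : LevelEmb y Z m) (cs : Vec (Fin 2) m) →
    Canonical cs λ σ τ → branch i (embed E σ) (embed E τ)
  branchCanonical i = canonical m y Z ≤-refl (branch i) λ σ τ |σ| |τ| →
    χ-sym _ _ (cong suc (embed-length (Fs (to g i)) |σ|)) (cong suc (embed-length (Fs (to g i)) |τ|))
  Eᵢ : Fin Y₀ → LevelEmb y Z m
  Eᵢ i = proj₁ (branchCanonical i)
  levels : Fin Y₀ → Vec (Fin 2) m
  levels i = proj₁ (proj₂ (branchCanonical i))
  sameLevels = pigeonholeFin {2 ^ m} {y} ≤-refl (encode ∘ levels)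
  p = proj₁ sameLevels
  a : Fin y → Fin R
  a j = to g (to p j)
  a-injective : ∀ {i j} → a i ≡ a j → i ≡ j
  a-injective {i} {j} = Injection.injective p {i} {j} ∘ Injection.injective g {to p i} {to p j}
  E : LevelEmb y B (suc m)
  E = node (↣-trans p (↣-trans g ι)) λ j → Fs (a j) ⊙ Eᵢ (to p j)
  embed-E : ∀ j σ → embed E (j ∷ σ) ≡ to ι (a j) ∷ embed (Fs (a j)) (embed (Eᵢ (to p j)) σ)
  embed-E j σ = cong (to ι (a j) ∷_) (embed-⊙ (Fs (a j)) (Eᵢ (to p j)) σ)
  split : ∀ {i j} → i ≢ j → ∀ σ τ → length σ ≡ m → length τ ≡ m →
    χ (embed E (i ∷ σ)) (embed E (j ∷ τ)) ≡ c₁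
  split {i} {j} i≢j σ τ |σ| |τ| = begin
    χ (embed E (i ∷ σ)) (embed E (j ∷ τ))
      ≡⟨ cong₂ χ (embed-E i σ) (embed-E j τ) ⟩
    χ (to ι (a i) ∷ embed (Fs (a i)) σ′) (to ι (a j) ∷ embed (Fs (a j)) τ′)
      ≡⟨ branchColour {a i} {a j} (i≢j ∘ a-injective) σ′ τ′
           (embed-length (Eᵢ (to p i)) |σ|) (embed-length (Eᵢ (to p j)) |τ|) ⟩
    col (a i) (a j)
      ≡⟨ proj₂ (proj₂ pairs) {to p i} {to p j} (i≢j ∘ Injection.injective p {i} {j}) ⟩
    c₁ ∎
    where
    open ≡-Reasoning
    σ′ = embed (Eᵢ (to p i)) σ
    τ′ = embed (Eᵢ (to p j)) τ
  below : ∀ j → Canonical (levels (to p 0F)) λ σ τ → χ (embed E (j ∷ σ)) (embed E (j ∷ τ))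
  below j = subst (λ cs → Canonical cs χⱼ) (encode-injective (proj₂ sameLevels j 0F))
    (Canonical-cong (levels (to p j)) {χ′ = χⱼ} (λ σ τ → sym (cong₂ χ (embed-E j σ) (embed-E j τ)))
      (proj₂ (proj₂ (branchCanonical (to p j)))))
    where
    χⱼ = λ σ τ → χ (embed E (j ∷ σ)) (embed E (j ∷ τ))

-- Embeds x^{≤k} into (suc x)^{≤m}, where k is the number of marked levels.
spread : ∀ {x m} → Vec Bool m → List (Fin x) → List (Fin (suc x))
spread [] σ = []
spread (false ∷ ms) σ = 0F ∷ spread ms σ
spread (true ∷ ms) [] = []
spread (true ∷ ms) (i ∷ σ) = Fin.suc i ∷ spread ms σ

module _ {x : ℕ} where

  spread-length-≤ : ∀ {m} (ms : Vec Bool m) (σ : List (Fin x)) → length (spread ms σ) ≤ m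
  spread-length-≤ [] σ = z≤n
  spread-length-≤ (false ∷ ms) σ = s≤s (spread-length-≤ ms σ)
  spread-length-≤ (true ∷ ms) [] = z≤n
  spread-length-≤ (true ∷ ms) (i ∷ σ) = s≤s (spread-length-≤ ms σ)

  spread-length : ∀ {m} (ms : Vec Bool m) (σ : List (Fin x)) → length σ ≡ Vec.count T? ms → length (spread ms σ) ≡ m
  spread-length [] σ _ = refl
  spread-length (false ∷ ms) σ eq = cong suc (spread-length ms σ eq)
  spread-length (true ∷ ms) (i ∷ σ) eq = cong suc (spread-length ms σ (suc-injective eq))

  spread-mono : ∀ {m} (ms : Vec Bool m) {σ τ : List (Fin x)} → σ ⪯ τ → spread ms σ ⪯ spread ms τ
  spread-mono [] _ = [] , refl
  spread-mono (false ∷ ms) σ⪯τ = ∷-⪯ 0F (spread-mono ms σ⪯τ)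
  spread-mono (true ∷ ms) {[]} _ = []⪯ _
  spread-mono (true ∷ ms) {i ∷ σ} {[]} σ⪯τ = ⊥-elim (∷⋠[] σ⪯τ)
  spread-mono (true ∷ ms) {i ∷ σ} {j ∷ τ} σ⪯τ with ∷-⪯⁻ σ⪯τ
  ... | refl , σ⪯τ′ = ∷-⪯ (Fin.suc i) (spread-mono ms σ⪯τ′)

  spread-reflects : ∀ {m} (ms : Vec Bool m) (σ τ : List (Fin x)) →
    length σ ≤ Vec.count T? ms → length τ ≤ Vec.count T? ms → spread ms σ ⪯ spread ms τ → σ ⪯ τ
  spread-reflects [] σ τ σ≤0 τ≤0 _ rewrite length≤0 σ σ≤0 | length≤0 τ τ≤0 = [] , refl
  spread-reflects (false ∷ ms) σ τ σ≤ τ≤ σ⪯τ = spread-reflects ms σ τ σ≤ τ≤ (proj₂ (∷-⪯⁻ σ⪯τ))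
  spread-reflects (true ∷ ms) [] τ _ _ _ = []⪯ τ
  spread-reflects (true ∷ ms) (i ∷ σ) [] _ _ σ⪯τ = ⊥-elim (∷⋠[] σ⪯τ)
  spread-reflects (true ∷ ms) (i ∷ σ) (j ∷ τ) (s≤s σ≤) (s≤s τ≤) σ⪯τ with ∷-⪯⁻ σ⪯τ
  ... | refl , σ⪯τ′ = ∷-⪯ i (spread-reflects ms σ τ σ≤ τ≤ σ⪯τ′)

  spread-canonical : ∀ {m} (ms : Vec Bool m) (cs : Vec (Fin 2) m) {c}
    (χ : List (Fin (suc x)) → List (Fin (suc x)) → Fin 2) →
    Canonical cs χ → (∀ l → Vec.lookup ms l ≡ true → Vec.lookup cs l ≡ c) →
    ∀ σ τ → length σ ≡ Vec.count T? ms → length τ ≡ Vec.count T? ms → σ ≢ τ →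
    χ (spread ms σ) (spread ms τ) ≡ c
  spread-canonical [] [] χ _ _ [] [] _ _ []≢[] = ⊥-elim ([]≢[] refl)
  spread-canonical (false ∷ ms) (d ∷ cs) χ (_ , below) marked σ τ |σ| |τ| σ≢τ =
    spread-canonical ms cs _ (below 0F) (marked ∘ Fin.suc) σ τ |σ| |τ| σ≢τ
  spread-canonical (true ∷ ms) (d ∷ cs) χ (split , below) marked (i ∷ σ) (j ∷ τ) |σ| |τ| σ≢τ
    with i Fin.≟ j
  ... | yes refl = spread-canonical ms cs _ (below (Fin.suc i)) (marked ∘ Fin.suc) σ τ
                     (suc-injective |σ|) (suc-injective |τ|) (σ≢τ ∘ cong (i ∷_))
  ... | no i≢j = trans (split (i≢j ∘ Fin-suc-injective) _ _
                   (spread-length ms σ (suc-injective |σ|)) (spread-length ms τ (suc-injective |τ|)))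
                   (marked 0F refl)

firstMarks : ∀ {m} → Fin 2 → ℕ → Vec (Fin 2) m → Vec Bool m
firstMarks c k [] = []
firstMarks c zero (d ∷ cs) = false ∷ firstMarks c zero cs
firstMarks c (suc k) (d ∷ cs) with d Fin.≟ c
... | yes _ = true ∷ firstMarks c k cs
... | no _ = false ∷ firstMarks c (suc k) cs

count-firstMarks : ∀ {m} c k (cs : Vec (Fin 2) m) → k ≤ Vec.count (Fin._≟ c) cs →
  Vec.count T? (firstMarks c k cs) ≡ k
count-firstMarks c k [] k≤0 = sym (n≤0⇒n≡0 k≤0)
count-firstMarks c zero (d ∷ cs) _ = count-firstMarks c zero cs z≤n
count-firstMarks c (suc k) (d ∷ cs) k≤ with d Fin.≟ c
... | yes _ = cong suc (count-firstMarks c k cs (≤-pred k≤))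
... | no _ = count-firstMarks c (suc k) cs k≤

firstMarks-colour : ∀ {m} c k (cs : Vec (Fin 2) m) l →
  Vec.lookup (firstMarks c k cs) l ≡ true → Vec.lookup cs l ≡ c
firstMarks-colour c zero (d ∷ cs) (Fin.suc l) marked = firstMarks-colour c zero cs l marked
firstMarks-colour c (suc k) (d ∷ cs) l marked with d Fin.≟ c | l
... | yes d≡c | 0F = d≡c
... | yes _ | Fin.suc l′ = firstMarks-colour c k cs l′ marked
... | no _ | Fin.suc l′ = firstMarks-colour c (suc k) cs l′ marked

count-0F+count-1F : ∀ {m} (cs : Vec (Fin 2) m) → Vec.count (Fin._≟ 0F) cs + Vec.count (Fin._≟ 1F) cs ≡ m
count-0F+count-1F [] = refl
count-0F+count-1F (0F ∷ cs) = cong suc (count-0F+count-1F cs)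
count-0F+count-1F (1F ∷ cs) = trans (+-suc _ _) (cong suc (count-0F+count-1F cs))

<-half⇒≤-half : ∀ n {a b} → a + b ≡ 2 * n ∸ 1 → a < n → n ≤ b
<-half⇒≤-half zero _ _ = z≤n
<-half⇒≤-half (suc n) {a} {b} a+b≡ (s≤s a≤n) = +-cancelˡ-≤ n _ _ (begin
  n + suc n          ≡⟨ cong (n +_) (+-identityʳ (suc n)) ⟨
  n + (suc n + 0)    ≡⟨ a+b≡ ⟨
  a + b              ≤⟨ +-monoˡ-≤ b a≤n ⟩
  n + b              ∎)
  where open ≤-Reasoning

monochromaticLevels : ∀ n (cs : Vec (Fin 2) (2 * n ∸ 1)) → ∃₂ λ c (ms : Vec Bool (2 * n ∸ 1)) →
  Vec.count T? ms ≡ n × (∀ l → Vec.lookup ms l ≡ true → Vec.lookup cs l ≡ c)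
monochromaticLevels n cs with n ≤? Vec.count (Fin._≟ 0F) cs
... | yes enough = 0F , firstMarks 0F n cs , count-firstMarks 0F n cs enough , firstMarks-colour 0F n cs
... | no few = 1F , firstMarks 1F n cs ,
  count-firstMarks 1F n cs (<-half⇒≤-half n (count-0F+count-1F cs) (≰⇒> few)) , firstMarks-colour 1F n cs

-- Primitive recursiveness of the bound

IsPR : ∀ k → (Vec ℕ k → ℕ) → Set
IsPR k F = Σ (PR k) λ t → ∀ xs → eval t xs ≡ F xs

module _ {k : ℕ} where

  zeroᴾ : IsPR k (const 0)
  zeroᴾ = zeroF , λ _ → refl

  varᴾ : (i : Fin k) → IsPR k (λ xs → Vec.lookup xs i)
  varᴾ i = projF i , λ _ → refl

  sucᴾ : ∀ {F} → IsPR k F → IsPR k (suc ∘ F)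
  sucᴾ (t , t≡) = compF succF (t ∷ []) , cong suc ∘ t≡

  app₁ᴾ : ∀ {G F} → IsPR 1 G → IsPR k F → IsPR k (λ xs → G (F xs ∷ []))
  app₁ᴾ {G} (g , g≡) (t , t≡) = compF g (t ∷ []) , λ xs → trans (g≡ _) (cong (λ a → G (a ∷ [])) (t≡ xs))

  app₂ᴾ : ∀ {G F₁ F₂} → IsPR 2 G → IsPR k F₁ → IsPR k F₂ → IsPR k (λ xs → G (F₁ xs ∷ F₂ xs ∷ []))
  app₂ᴾ {G} (g , g≡) (t₁ , t₁≡) (t₂ , t₂≡) =
    compF g (t₁ ∷ t₂ ∷ []) , λ xs → trans (g≡ _) (cong₂ (λ a b → G (a ∷ b ∷ [])) (t₁≡ xs) (t₂≡ xs))

  recᴾ : ∀ {G H} → IsPR k G → IsPR (suc (suc k)) H → (F : Vec ℕ (suc k) → ℕ) →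
    (∀ xs → F (0 ∷ xs) ≡ G xs) → (∀ y xs → F (suc y ∷ xs) ≡ H (y ∷ F (y ∷ xs) ∷ xs)) → IsPR (suc k) F
  recᴾ {G} {H} (g , g≡) (h , h≡) F F-zero F-suc = recF g h , computes
    where
    computes : ∀ xs → eval (recF g h) xs ≡ F xs
    computes (zero ∷ xs) = trans (g≡ xs) (sym (F-zero xs))
    computes (suc y ∷ xs) =
      trans (h≡ _) (trans (cong (λ a → H (y ∷ a ∷ xs)) (computes (y ∷ xs))) (sym (F-suc y xs)))

addᴾ : IsPR 2 λ xs → Vec.lookup xs 0F + Vec.lookup xs 1F
addᴾ = recᴾ (varᴾ 0F) (sucᴾ (varᴾ 1F)) _ (λ _ → refl) (λ _ _ → refl)

mulᴾ : IsPR 2 λ xs → Vec.lookup xs 0F * Vec.lookup xs 1F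
mulᴾ = recᴾ zeroᴾ (app₂ᴾ addᴾ (varᴾ (Fin.suc 1F)) (varᴾ 1F)) _ (λ _ → refl) (λ _ _ → refl)

powᴾ : IsPR 2 λ xs → Vec.lookup xs 1F ^ Vec.lookup xs 0F
powᴾ = recᴾ (sucᴾ zeroᴾ) (app₂ᴾ mulᴾ (varᴾ (Fin.suc 1F)) (varᴾ 1F)) _ (λ _ → refl) (λ _ _ → refl)

predᴾ : IsPR 1 λ xs → Vec.lookup xs 0F ∸ 1
predᴾ = recᴾ zeroᴾ (varᴾ 0F) _ (λ _ → refl) (λ _ _ → refl)

iterateᴾ : ∀ {f} → IsPR 1 (λ xs → f (Vec.lookup xs 0F)) →
  IsPR 2 λ xs → iterate f (Vec.lookup xs 0F) (Vec.lookup xs 1F)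
iterateᴾ fᴾ = recᴾ (varᴾ 0F) (app₁ᴾ fᴾ (varᴾ 1F)) _ (λ _ → refl) (λ _ _ → refl)

module _ {k : ℕ} where

  infixl 6 _+ᴾ_
  infixl 7 _*ᴾ_
  infixr 8 _^ᴾ_

  _+ᴾ_ : ∀ {F G} → IsPR k F → IsPR k G → IsPR k λ xs → F xs + G xs
  _+ᴾ_ = app₂ᴾ addᴾ

  _*ᴾ_ : ∀ {F G} → IsPR k F → IsPR k G → IsPR k λ xs → F xs * G xs
  _*ᴾ_ = app₂ᴾ mulᴾ

  _^ᴾ_ : ∀ {F G} → IsPR k F → IsPR k G → IsPR k λ xs → F xs ^ G xs
  fᴾ ^ᴾ gᴾ = app₂ᴾ powᴾ gᴾ fᴾ

gridStepᴾ : IsPR 1 λ xs → gridStep (Vec.lookup xs 0F)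
gridStepᴾ = sucᴾ (s *ᴾ s) +ᴾ (sucᴾ s ^ᴾ sucᴾ (s *ᴾ s) +ᴾ s)
  where s = varᴾ 0F

gridBoundᴾ : IsPR 1 λ xs → gridBound (Vec.lookup xs 0F)
gridBoundᴾ = app₂ᴾ (iterateᴾ gridStepᴾ) (varᴾ 0F) (varᴾ 0F)

treeStepᴾ : IsPR 1 λ xs → treeStep (Vec.lookup xs 0F)
treeStepᴾ = s *ᴾ G +ᴾ (sucᴾ s ^ᴾ (sucᴾ G ^ᴾ s) +ᴾ (s +ᴾ G))
  where
  s = varᴾ 0F
  G = app₁ᴾ gridBoundᴾ s

canonicalBoundᴾ : IsPR 2 λ xs → canonicalBound (Vec.lookup xs 0F) (Vec.lookup xs 1F)
canonicalBoundᴾ = recᴾ (sucᴾ zeroᴾ) stepᴾ _ (λ _ → refl) (λ _ _ → refl)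
  where
  m = varᴾ 0F
  Z = varᴾ 1F
  y = varᴾ (Fin.suc 1F)
  two = sucᴾ (sucᴾ zeroᴾ)
  Y₀ = sucᴾ (y *ᴾ two ^ᴾ m)
  R = two ^ᴾ (Y₀ +ᴾ Y₀)
  stepᴾ = R +ᴾ app₂ᴾ (iterateᴾ treeStepᴾ) m (R +ᴾ (two ^ᴾ (R *ᴾ R) +ᴾ Z))

bound : ℕ → ℕ → ℕ
bound n x = canonicalBound (2 * n ∸ 1) (suc x)

bound-primRec : PrimRec₂ bound
bound-primRec = proj₁ boundᴾ , λ n x → proj₂ boundᴾ (n ∷ x ∷ [])
  where
  boundᴾ : IsPR 2 λ xs → bound (Vec.lookup xs 0F) (Vec.lookup xs 1F)
  boundᴾ = app₂ᴾ canonicalBoundᴾ (app₁ᴾ predᴾ (sucᴾ (sucᴾ zeroᴾ) *ᴾ varᴾ 0F)) (sucᴾ (varᴾ 1F))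

PrefixEmbedding : ∀ {A C : Set} → ℕ → (List A → List C) → Set
PrefixEmbedding n g = ∀ σ τ → length σ ≤ n → length τ ≤ n → σ ⪯ τ ⇔ g σ ⪯ g τ

PrefixEmbedding-∘ : ∀ {A C D : Set} {m n} {g : List C → List D} {h : List A → List C} →
  PrefixEmbedding m g → PrefixEmbedding n h → (∀ σ → length (h σ) ≤ m) → PrefixEmbedding n (g ∘ h)
PrefixEmbedding-∘ g-emb h-emb h≤m σ τ |σ| |τ| = g-emb _ _ (h≤m σ) (h≤m τ) ⇔-∘ h-emb σ τ |σ| |τ|

embed-prefixEmbedding : ∀ {y B m} (E : LevelEmb y B m) → PrefixEmbedding m (embed E)
embed-prefixEmbedding E σ τ |σ| |τ| = mk⇔ (embed-mono E) (embed-reflects E σ τ |σ| |τ|)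

spread-prefixEmbedding : ∀ {x m} (ms : Vec Bool m) → PrefixEmbedding {Fin x} (Vec.count T? ms) (spread ms)
spread-prefixEmbedding ms σ τ |σ| |τ| = mk⇔ (spread-mono ms) (spread-reflects ms σ τ |σ| |τ|)

-- Junk beyond level d is cut off, so that every list names a node of B^{≤d}.
truncate : ∀ {B} d → List (Fin B) → Seq≤ B d
truncate d σ = take d σ , ≤-trans (≤-reflexive (length-take d σ)) (m⊓n≤m d _)

module _ {B d : ℕ} {φ : Seq≤ B d → List ℕ} where

  truncate-leaf : ∀ {σ} → length σ ≡ d → InLeaves φ (φ (truncate d σ))
  truncate-leaf {σ} |σ| = truncate d σ , trans (cong length (take-all d σ (≤-reflexive |σ|))) |σ| , refl

  IsTreeEmbedding-∘ : ∀ {x n} → IsTreeEmbedding φ → (g : List (Fin x) → List (Fin B)) →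
    (∀ σ → length (g σ) ≤ d) → PrefixEmbedding n g → IsTreeEmbedding {x} {n} (φ ∘ truncate d ∘ g ∘ proj₁)
  IsTreeEmbedding-∘ φ-tree g g≤d g-emb (σ , |σ|) (τ , |τ|) =
    φ-tree (truncate d (g σ)) (truncate d (g τ)) ⇔-∘
    subst₂ (λ a b → σ ⪯ τ ⇔ a ⪯ b) (sym (take-all d (g σ) (g≤d σ))) (sym (take-all d (g τ) (g≤d τ)))
      (g-emb σ τ |σ| |τ|)

proposition3p26 :
  Σ (ℕ → ℕ → ℕ) λ Bnd → PrimRec₂ Bnd ×
    (∀ (n x : ℕ) →
      ∀ (φ : Seq≤ (Bnd n x) (2 * n ∸ 1) → List ℕ) → IsTreeEmbedding φ →
      ∀ (f : List ℕ → List ℕ → Fin 2) →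
      (∀ a b → InLeaves φ a → InLeaves φ b → f a b ≡ f b a) →
      Σ (Seq≤ x n → List ℕ) λ ψ →
        IsTreeEmbedding ψ
        × (∀ σ → InTree φ (ψ σ))
        × (∀ (σ : Seq≤ x n) → length (proj₁ σ) ≡ n → InLeaves φ (ψ σ))
        × (∃ λ (c : Fin 2) → ∀ (σ τ : Seq≤ x n) →
             length (proj₁ σ) ≡ n → length (proj₁ τ) ≡ n →
             ψ σ ≢ ψ τ → f (ψ σ) (ψ τ) ≡ c))
proposition3p26 = bound , bound-primRec , λ n x φ φ-tree f f-sym →
  let m = 2 * n ∸ 1
      χ = λ σ τ → f (φ (truncate m σ)) (φ (truncate m τ))
      E , cs , E-canonical = canonical m (suc x) (bound n x) ≤-refl χ
                               λ σ τ |σ| |τ| → f-sym _ _ (truncate-leaf |σ|) (truncate-leaf |τ|)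
      c , ms , |ms| , ms-colour = monochromaticLevels n cs
      g = embed E ∘ spread ms
      leaf-count = λ (σ : List (Fin x)) (|σ| : length σ ≡ n) → trans |σ| (sym |ms|)
  in φ ∘ truncate m ∘ g ∘ proj₁
   , IsTreeEmbedding-∘ φ-tree g (λ σ → embed-length-≤ E (spread ms σ))
       (PrefixEmbedding-∘ (embed-prefixEmbedding E)
          (subst (λ k → PrefixEmbedding k (spread ms)) |ms| (spread-prefixEmbedding ms)) (spread-length-≤ ms))
   , (λ σ → truncate m (g (proj₁ σ)) , refl)
   , (λ σ |σ| → truncate-leaf (embed-length E (spread-length ms (proj₁ σ) (leaf-count (proj₁ σ) |σ|))))
   , c , λ σ τ |σ| |τ| ψσ≢ψτ → spread-canonical ms cs _ E-canonical ms-colour _ _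
                                  (leaf-count (proj₁ σ) |σ|) (leaf-count (proj₁ τ) |τ|)
                                  (ψσ≢ψτ ∘ cong (φ ∘ truncate m ∘ g))
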